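{- For any instance (edge weights $X$ on $K_n$), any initial configuration and any pivoting rule, the move sequence generated by an execution of 2-FLIP (or by Pure 2-FLIP) is valid.
   Context: $K_n=(V_n,E_n)$ is the complete graph on $V_n=[n]$ with edge weights $X_e\in[-1,1]$; configurations are $\gamma\in\{\pm1\}^n$ with objective $\mathrm{obj}_X(\gamma)=\sum_{\{u,v\}\in E_n}X_{\{u,v\}}\mathbf{1}\{\gamma(u)\neq\gamma(v)\}$. 2-FLIP repeatedly moves from the current configuration to one differing in one or two coordinates with strictly larger objective, with a pivoting rule that never flips a pair of nodes when flipping only one of them would yield a strictly larger objective; Pure 2-FLIP only performs improving moves that flip exactly two nodes. The move sequence of an execution is $\mathcal{S}=(\mathcal{S}_1,\dots,\mathcal{S}_\ell)$ where $\mathcal{S}_i\subseteq V_n$ is the set of nodes flipped in step $i$. A move sequence $\mathcal{S}$ is valid if for every $i<j\le\ell$ there is at least one node $w\notin\mathcal{S}_i$ that belongs to an odd number of the sets $\mathcal{S}_i,\mathcal{S}_{i+1},\dots,\mathcal{S}_j$.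
   Formalization: The edge weights $X_e$ are rational numbers in [-1,1] rather than real numbers. -}

module Defs where

open import Data.Bool using (Bool; true; false; if_then_else_; _xor_; _∧_)
open import Data.Nat using (ℕ; zero; suc; _∸_; _%_; _<ᵇ_) renaming (_+_ to _+ℕ_; _<_ to _<ℕ_)
open import Data.Fin using (Fin; toℕ)
open import Data.Fin.Subset using (Subset; ⁅_⁆; ∣_∣; _∈_; _∉_)
open import Data.Vec using (Vec; lookup; zipWith)
open import Data.List using (List; []; _∷_; length; take; drop; allFin; foldr; map)
open import Data.Rational using (ℚ; 0ℚ; 1ℚ; -_; _+_; _<_; _≤_)
open import Data.Product using (_×_; ∃-syntax)
open import Data.Sum using (_⊎_)
open import Relation.Binary.PropositionalEquality using (_≡_)
open import Relation.Nullary using (¬_)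

-- A configuration γ ∈ {±1}^n, encoded as a Boolean vector (true = +1).
Config : ℕ → Set
Config n = Vec Bool n

-- Edge weights: X u v is the weight of edge {u,v}, read only for toℕ u < toℕ v.
Weights : ℕ → Set
Weights n = Fin n → Fin n → ℚ

WeightsInRange : ∀ {n} → Weights n → Set
WeightsInRange {n} X = ∀ (u v : Fin n) → toℕ u <ℕ toℕ v → (- 1ℚ ≤ X u v) × (X u v ≤ 1ℚ)

sumℚ : List ℚ → ℚ
sumℚ = foldr _+_ 0ℚ

obj : ∀ {n} → Weights n → Config n → ℚ
obj {n} X γ = sumℚ (map (λ u → sumℚ (map (λ v →
  if (toℕ u <ᵇ toℕ v) ∧ (lookup γ u xor lookup γ v) then X u v else 0ℚ)
  (allFin n))) (allFin n))

flipSet : ∀ {n} → Config n → Subset n → Config n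
flipSet γ S = zipWith _xor_ γ S

-- One step of 2-FLIP from γ flipping the set S (one or two nodes), strictly
-- improving, and obeying the pivoting restriction: a pair is never flipped if
-- flipping only one of its nodes yields a strictly larger objective.
Move2 : ∀ {n} → Weights n → Config n → Subset n → Set
Move2 X γ S =
  (∣ S ∣ ≡ 1 ⊎ ∣ S ∣ ≡ 2)
  × (obj X γ < obj X (flipSet γ S))
  × (∣ S ∣ ≡ 2 → ∀ a → a ∈ S → ¬ (obj X (flipSet γ S) < obj X (flipSet γ ⁅ a ⁆)))

MovePure : ∀ {n} → Weights n → Config n → Subset n → Set
MovePure X γ S = (∣ S ∣ ≡ 2) × (obj X γ < obj X (flipSet γ S))

LocOpt2 : ∀ {n} → Weights n → Config n → Set
LocOpt2 X γ = ∀ S → (∣ S ∣ ≡ 1 ⊎ ∣ S ∣ ≡ 2) → ¬ (obj X γ < obj X (flipSet γ S))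

LocOptPure : ∀ {n} → Weights n → Config n → Set
LocOptPure X γ = ∀ S → ∣ S ∣ ≡ 2 → ¬ (obj X γ < obj X (flipSet γ S))

-- Run2 X γ Ss : Ss is the move sequence of a (complete) execution of 2-FLIP
-- started at γ (under some pivoting rule).
data Run2 {n} (X : Weights n) : Config n → List (Subset n) → Set where
  done : ∀ {γ} → LocOpt2 X γ → Run2 X γ []
  step : ∀ {γ S Ss} → Move2 X γ S → Run2 X (flipSet γ S) Ss → Run2 X γ (S ∷ Ss)

data RunPure {n} (X : Weights n) : Config n → List (Subset n) → Set where
  done : ∀ {γ} → LocOptPure X γ → RunPure X γ []
  step : ∀ {γ S Ss} → MovePure X γ S → RunPure X (flipSet γ S) Ss → RunPure X γ (S ∷ Ss)

countIn : ∀ {n} → Fin n → List (Subset n) → ℕ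
countIn w [] = 0
countIn w (S ∷ Ss) = (if lookup S w then 1 else 0) +ℕ countIn w Ss

Odd : ℕ → Set
Odd k = k % 2 ≡ 1

-- the sets S_i, S_{i+1}, ..., S_j (0-indexed positions i ≤ j)
segment : ∀ {n} (Ss : List (Subset n)) → Fin (length Ss) → Fin (length Ss) → List (Subset n)
segment Ss i j = take (suc (toℕ j) ∸ toℕ i) (drop (toℕ i) Ss)

Valid : ∀ {n} → List (Subset n) → Set
Valid {n} Ss = ∀ (i j : Fin (length Ss)) → toℕ i <ℕ toℕ j →
  ∃[ w ] (w ∉ Data.List.lookup Ss i) × Odd (countIn w (segment Ss i j))

-- Let γ be the configuration before step i and P the set of nodes lying in an
-- odd number of S_i, …, S_j; after step j the configuration is γ flipped at P.
-- If no node outside S_i lies in P, then P ⊆ S_i. Since j > i the objective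
-- keeps increasing after step i, so flipping P from γ strictly beats flipping
-- S_i, which strictly beats γ; hence P is neither ∅ nor S_i, so S_i is a pair
-- and P is one of its nodes. The pivoting rule of 2-FLIP forbids exactly this,
-- and in Pure 2-FLIP every move has even size, so P has even size and is no single node.
module Submission where

open import Defs
open import Data.Nat using (ℕ; suc; _+_; _%_; _≤_; s≤s)
open import Data.List using (List; []; _∷_; foldr; foldl; take; length)
open import Data.Fin.Subset using (Subset; ⊥; ⁅_⁆; ∣_∣; _∈_; _∉_; _⊆_)
open import Data.Product using (_×_; ∃-syntax; _,_)

open import Algebra.Bundles using (CommutativeRing)
open import Data.Bool using (Bool; true; false; if_then_else_; _xor_)
open import Data.Bool.Properties using (xor-assoc; xor-identityʳ; xor-∧-commutativeRing)
open import Data.Nat.Properties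
  using (≤-trans; ≤-reflexive; suc-injective; n<1⇒n≡0; m≤n⇒m<n∨m≡n; 1+n≰n)
open import Data.Nat.DivMod using (%-distribˡ-+)
open import Data.Fin using (Fin; toℕ) renaming (zero to fzero; suc to fsuc)
open import Data.Fin.Properties using (any?)
open import Data.Fin.Subset.Properties
  using (_∈?_; p⊆q⇒∣p∣≤∣q∣; drop-∷-⊆; x∈⁅x⁆; ∣⁅x⁆∣≡1; ∣⊥∣≡0)
open import Data.Vec using ([]; _∷_; lookup; zipWith; here)
open import Data.Vec.Properties
  using (zipWith-assoc; zipWith-identityʳ; lookup-zipWith; lookup-replicate; []=⇒lookup)
open import Data.List.Relation.Unary.All using (All; []; _∷_)
open import Data.List.Relation.Unary.All.Properties using (take⁺)
open import Data.Rational using (ℚ; _<_)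
open import Data.Rational.Properties using (<-asym; <-irrefl; <-trans)
open import Data.Sum using (_⊎_; inj₁; inj₂)
open import Data.Empty using (⊥-elim)
open import Relation.Nullary using (¬_; yes; no)
open import Relation.Nullary.Decidable using (_×-dec_; ¬?)
open import Relation.Binary.PropositionalEquality
  using (_≡_; _≢_; refl; sym; trans; cong; subst; module ≡-Reasoning)
open import Algebra.Properties.CommutativeSemigroup
  (CommutativeRing.+-commutativeSemigroup xor-∧-commutativeRing) using (interchange)

private
  variable
    n : ℕ

bit : Bool → ℕ
bit b = if b then 1 else 0

bit-injective : ∀ {a b} → bit a ≡ bit b → a ≡ b
bit-injective {false} {false} _ = refl
bit-injective {true}  {true}  _ = refl

%2-bit-xor : ∀ a m {b} → m % 2 ≡ bit b → (bit a + m) % 2 ≡ bit (a xor b)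
%2-bit-xor a m {b} m%2≡b = begin
  (bit a + m) % 2              ≡⟨ %-distribˡ-+ (bit a) m 2 ⟩
  (bit a % 2 + m % 2) % 2      ≡⟨ cong (λ r → (bit a % 2 + r) % 2) m%2≡b ⟩
  (bit a % 2 + bit b) % 2      ≡⟨ table a b ⟩
  bit (a xor b)                ∎
  where
  open ≡-Reasoning
  table : ∀ a b → (bit a % 2 + bit b) % 2 ≡ bit (a xor b)
  table false false = refl
  table false true  = refl
  table true  false = refl
  table true  true  = refl

_⊕_ : Subset n → Subset n → Subset n
_⊕_ = zipWith _xor_

⨁ : List (Subset n) → Subset n
⨁ = foldr _⊕_ ⊥

flips : Config n → List (Subset n) → Config n
flips = foldl flipSet

flipSet-⊥ : (γ : Config n) → flipSet γ ⊥ ≡ γ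
flipSet-⊥ = zipWith-identityʳ xor-identityʳ

flips-⨁ : (γ : Config n) (Ss : List (Subset n)) → flips γ Ss ≡ flipSet γ (⨁ Ss)
flips-⨁ γ []       = sym (flipSet-⊥ γ)
flips-⨁ γ (S ∷ Ss) = trans (flips-⨁ (flipSet γ S) Ss) (zipWith-assoc xor-assoc γ S (⨁ Ss))

countIn-%2 : (w : Fin n) (Ss : List (Subset n)) → countIn w Ss % 2 ≡ bit (lookup (⨁ Ss) w)
countIn-%2 w []       = cong bit (sym (lookup-replicate w false))
countIn-%2 w (S ∷ Ss) rewrite lookup-zipWith _xor_ w S (⨁ Ss) =
  %2-bit-xor (lookup S w) (countIn w Ss) (countIn-%2 w Ss)

∈-⨁⇒odd : (w : Fin n) (Ss : List (Subset n)) → w ∈ ⨁ Ss → Odd (countIn w Ss)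
∈-⨁⇒odd w Ss w∈⨁ = trans (countIn-%2 w Ss) (cong bit ([]=⇒lookup w∈⨁))

parity : Subset n → Bool
parity []      = false
parity (x ∷ p) = x xor parity p

parity-⊕ : (p q : Subset n) → parity (p ⊕ q) ≡ parity p xor parity q
parity-⊕ []      []      = refl
parity-⊕ (x ∷ p) (y ∷ q) =
  trans (cong ((x xor y) xor_) (parity-⊕ p q)) (interchange x y (parity p) (parity q))

∣∣-%2 : (p : Subset n) → ∣ p ∣ % 2 ≡ bit (parity p)
∣∣-%2 []          = refl
∣∣-%2 (false ∷ p) = %2-bit-xor false ∣ p ∣ (∣∣-%2 p)
∣∣-%2 (true ∷ p)  = %2-bit-xor true ∣ p ∣ (∣∣-%2 p)

parity-from-∣∣ : (p : Subset n) {b : Bool} → ∣ p ∣ % 2 ≡ bit b → parity p ≡ b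
parity-from-∣∣ p ∣p∣%2≡b = bit-injective (trans (sym (∣∣-%2 p)) ∣p∣%2≡b)

parity-⨁-pairs : {Ss : List (Subset n)} → All (λ S → ∣ S ∣ ≡ 2) Ss → parity (⨁ Ss) ≡ false
parity-⨁-pairs {n} []  = parity-from-∣∣ (⊥ {n}) (cong (_% 2) (∣⊥∣≡0 n))
parity-⨁-pairs {Ss = S ∷ Ss} (∣S∣≡2 ∷ pairs) = begin
  parity (S ⊕ ⨁ Ss)              ≡⟨ parity-⊕ S (⨁ Ss) ⟩
  parity S xor parity (⨁ Ss)     ≡⟨ cong (_xor parity (⨁ Ss)) S-even ⟩
  parity (⨁ Ss)                  ≡⟨ parity-⨁-pairs pairs ⟩
  false                           ∎
  where
  open ≡-Reasoning
  S-even : parity S ≡ false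
  S-even = parity-from-∣∣ S (cong (_% 2) ∣S∣≡2)

parity-⁅⁆ : (a : Fin n) → parity ⁅ a ⁆ ≡ true
parity-⁅⁆ a = parity-from-∣∣ ⁅ a ⁆ (cong (_% 2) (∣⁅x⁆∣≡1 a))

∣p∣≡0⇒p≡⊥ : {p : Subset n} → ∣ p ∣ ≡ 0 → p ≡ ⊥
∣p∣≡0⇒p≡⊥ {p = []}        _       = refl
∣p∣≡0⇒p≡⊥ {p = false ∷ p} ∣p∣≡0 = cong (false ∷_) (∣p∣≡0⇒p≡⊥ ∣p∣≡0)

∣p∣≡1⇒p≡⁅x⁆ : {p : Subset n} → ∣ p ∣ ≡ 1 → ∃[ x ] p ≡ ⁅ x ⁆
∣p∣≡1⇒p≡⁅x⁆ {p = true ∷ p}  ∣p∣≡1 = fzero , cong (true ∷_) (∣p∣≡0⇒p≡⊥ (suc-injective ∣p∣≡1))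
∣p∣≡1⇒p≡⁅x⁆ {p = false ∷ p} ∣p∣≡1 with ∣p∣≡1⇒p≡⁅x⁆ ∣p∣≡1
... | x , p≡⁅x⁆ = fsuc x , cong (false ∷_) p≡⁅x⁆

p⊆q∧∣p∣≡∣q∣⇒p≡q : {p q : Subset n} → p ⊆ q → ∣ p ∣ ≡ ∣ q ∣ → p ≡ q
p⊆q∧∣p∣≡∣q∣⇒p≡q {p = []}        {[]}        _   _   = refl
p⊆q∧∣p∣≡∣q∣⇒p≡q {p = false ∷ p} {false ∷ q} p⊆q eq =
  cong (false ∷_) (p⊆q∧∣p∣≡∣q∣⇒p≡q (drop-∷-⊆ p⊆q) eq)
p⊆q∧∣p∣≡∣q∣⇒p≡q {p = true ∷ p}  {true ∷ q}  p⊆q eq =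
  cong (true ∷_) (p⊆q∧∣p∣≡∣q∣⇒p≡q (drop-∷-⊆ p⊆q) (suc-injective eq))
p⊆q∧∣p∣≡∣q∣⇒p≡q {p = false ∷ p} {true ∷ q}  p⊆q eq =
  ⊥-elim (1+n≰n (subst (_≤ ∣ q ∣) eq (p⊆q⇒∣p∣≤∣q∣ (drop-∷-⊆ p⊆q))))
p⊆q∧∣p∣≡∣q∣⇒p≡q {p = true ∷ p}  {false ∷ q} p⊆q eq with () ← p⊆q here

⊆-singleton : {p q : Subset n} → p ⊆ q → ∣ q ∣ ≡ 1 → p ≡ ⊥ ⊎ p ≡ q
⊆-singleton p⊆q ∣q∣≡1 with m≤n⇒m<n∨m≡n (≤-trans (p⊆q⇒∣p∣≤∣q∣ p⊆q) (≤-reflexive ∣q∣≡1))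
... | inj₁ ∣p∣<1 = inj₁ (∣p∣≡0⇒p≡⊥ (n<1⇒n≡0 ∣p∣<1))
... | inj₂ ∣p∣≡1 = inj₂ (p⊆q∧∣p∣≡∣q∣⇒p≡q p⊆q (trans ∣p∣≡1 (sym ∣q∣≡1)))

⊆-pair : {p q : Subset n} → p ⊆ q → ∣ q ∣ ≡ 2 → p ≡ ⊥ ⊎ p ≡ q ⊎ ∃[ x ] p ≡ ⁅ x ⁆
⊆-pair p⊆q ∣q∣≡2 with m≤n⇒m<n∨m≡n (≤-trans (p⊆q⇒∣p∣≤∣q∣ p⊆q) (≤-reflexive ∣q∣≡2))
... | inj₂ ∣p∣≡2 = inj₂ (inj₁ (p⊆q∧∣p∣≡∣q∣⇒p≡q p⊆q (trans ∣p∣≡2 (sym ∣q∣≡2))))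
... | inj₁ (s≤s ∣p∣≤1) with m≤n⇒m<n∨m≡n ∣p∣≤1
...   | inj₁ ∣p∣<1 = inj₁ (∣p∣≡0⇒p≡⊥ (n<1⇒n≡0 ∣p∣<1))
...   | inj₂ ∣p∣≡1 = inj₂ (inj₂ (∣p∣≡1⇒p≡⁅x⁆ ∣p∣≡1))

¬⊆⇒∃∈∉ : {p q : Subset n} → ¬ (p ⊆ q) → ∃[ x ] x ∈ p × x ∉ q
¬⊆⇒∃∈∉ {p = p} {q} p⊈q with any? (λ x → (x ∈? p) ×-dec ¬? (x ∈? q))
... | yes witness = witness
... | no none = ⊥-elim (p⊈q p⊆q)
  where
  p⊆q : p ⊆ q
  p⊆q {x} x∈p with x ∈? q
  ... | yes x∈q = x∈q
  ... | no  x∉q = ⊥-elim (none (x , x∈p , x∉q))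

module _ (f : Config n → ℚ) where

  beats-improving-move⇒singleton : {γ : Config n} {S P : Subset n} →
    ∣ S ∣ ≡ 1 ⊎ ∣ S ∣ ≡ 2 → P ⊆ S →
    f γ < f (flipSet γ S) → f (flipSet γ S) < f (flipSet γ P) →
    ∣ S ∣ ≡ 2 × ∃[ a ] a ∈ S × P ≡ ⁅ a ⁆
  beats-improving-move⇒singleton {γ} {S} {P} size P⊆S γ<S S<P = singleton size
    where
    P≢⊥ : P ≢ ⊥
    P≢⊥ P≡⊥ = <-asym γ<S
      (subst (λ δ → f (flipSet γ S) < f δ) (trans (cong (flipSet γ) P≡⊥) (flipSet-⊥ γ)) S<P)
    P≢S : P ≢ S
    P≢S P≡S = <-irrefl refl (subst (λ Q → f (flipSet γ S) < f (flipSet γ Q)) P≡S S<P)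
    singleton : ∣ S ∣ ≡ 1 ⊎ ∣ S ∣ ≡ 2 → ∣ S ∣ ≡ 2 × ∃[ a ] a ∈ S × P ≡ ⁅ a ⁆
    singleton (inj₁ ∣S∣≡1) with ⊆-singleton P⊆S ∣S∣≡1
    ... | inj₁ P≡⊥ = ⊥-elim (P≢⊥ P≡⊥)
    ... | inj₂ P≡S = ⊥-elim (P≢S P≡S)
    singleton (inj₂ ∣S∣≡2) with ⊆-pair P⊆S ∣S∣≡2
    ... | inj₁ P≡⊥ = ⊥-elim (P≢⊥ P≡⊥)
    ... | inj₂ (inj₁ P≡S) = ⊥-elim (P≢S P≡S)
    ... | inj₂ (inj₂ (a , P≡⁅a⁆)) =
      ∣S∣≡2 , a , P⊆S (subst (a ∈_) (sym P≡⁅a⁆) (x∈⁅x⁆ a)) , P≡⁅a⁆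

  data Improving : Config n → List (Subset n) → Set where
    []  : {γ : Config n} → Improving γ []
    _∷_ : {γ : Config n} {S : Subset n} {Ss : List (Subset n)} →
          f γ < f (flipSet γ S) → Improving (flipSet γ S) Ss → Improving γ (S ∷ Ss)

  improving-take-suc : {γ : Config n} {Ss : List (Subset n)} → Improving γ Ss →
    (j : Fin (length Ss)) → f γ < f (flips γ (take (suc (toℕ j)) Ss))
  improving-take-suc (γ<S ∷ _)     fzero    = γ<S
  improving-take-suc (γ<S ∷ steps) (fsuc j) = <-trans γ<S (improving-take-suc steps j)

  improving-beats-first-move : {γ : Config n} {S : Subset n} {Ss : List (Subset n)} →
    Improving (flipSet γ S) Ss → (j : Fin (length Ss)) →
    f (flipSet γ S) < f (flipSet γ (⨁ (S ∷ take (suc (toℕ j)) Ss)))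
  improving-beats-first-move {γ} {S} {Ss} steps j =
    subst (λ δ → f (flipSet γ S) < f δ) (flips-⨁ γ (S ∷ take (suc (toℕ j)) Ss))
      (improving-take-suc steps j)

run2⇒improving : {X : Weights n} {γ : Config n} {Ss : List (Subset n)} →
  Run2 X γ Ss → Improving (obj X) γ Ss
run2⇒improving (done _)                 = []
run2⇒improving (step (_ , γ<S , _) run) = γ<S ∷ run2⇒improving run

runPure⇒improving : {X : Weights n} {γ : Config n} {Ss : List (Subset n)} →
  RunPure X γ Ss → Improving (obj X) γ Ss
runPure⇒improving (done _)             = []
runPure⇒improving (step (_ , γ<S) run) = γ<S ∷ runPure⇒improving run

runPure⇒pairs : {X : Weights n} {γ : Config n} {Ss : List (Subset n)} →
  RunPure X γ Ss → All (λ S → ∣ S ∣ ≡ 2) Ss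
runPure⇒pairs (done _)               = []
runPure⇒pairs (step (∣S∣≡2 , _) run) = ∣S∣≡2 ∷ runPure⇒pairs run

valid-∷ : {S : Subset n} {Ss : List (Subset n)} →
  ((j : Fin (length Ss)) → ∃[ w ] w ∉ S × Odd (countIn w (S ∷ take (suc (toℕ j)) Ss))) →
  Valid Ss → Valid (S ∷ Ss)
valid-∷ first _    fzero    (fsuc j) _         = first j
valid-∷ _     rest (fsuc i) (fsuc j) (s≤s i<j) = rest i j i<j

odd-outside : (S : Subset n) (Ss : List (Subset n)) →
  ¬ (⨁ (S ∷ Ss) ⊆ S) → ∃[ w ] w ∉ S × Odd (countIn w (S ∷ Ss))
odd-outside S Ss ⨁⊈S with ¬⊆⇒∃∈∉ ⨁⊈S
... | w , w∈⨁ , w∉S = w , w∉S , ∈-⨁⇒odd w (S ∷ Ss) w∈⨁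

module _ {X : Weights n} {γ : Config n} {S P : Subset n} where

  move2-beaten⇒⊈ : Move2 X γ S → obj X (flipSet γ S) < obj X (flipSet γ P) → ¬ (P ⊆ S)
  move2-beaten⇒⊈ (size , γ<S , pivot) S<P P⊆S
    with beats-improving-move⇒singleton (obj X) {γ} {S} {P} size P⊆S γ<S S<P
  ... | ∣S∣≡2 , a , a∈S , P≡⁅a⁆ =
    pivot ∣S∣≡2 a a∈S (subst (λ Q → obj X (flipSet γ S) < obj X (flipSet γ Q)) P≡⁅a⁆ S<P)

  movePure-beaten⇒⊈ : MovePure X γ S → parity P ≡ false →
    obj X (flipSet γ S) < obj X (flipSet γ P) → ¬ (P ⊆ S)
  movePure-beaten⇒⊈ (∣S∣≡2 , γ<S) even S<P P⊆S
    with beats-improving-move⇒singleton (obj X) {γ} {S} {P} (inj₂ ∣S∣≡2) P⊆S γ<S S<P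
  ... | _ , a , _ , P≡⁅a⁆ with () ← trans (sym even) (trans (cong parity P≡⁅a⁆) (parity-⁅⁆ a))

run2-valid : {X : Weights n} {γ : Config n} {Ss : List (Subset n)} → Run2 X γ Ss → Valid Ss
run2-valid (done _) = λ ()
run2-valid {X = X} {γ} (step {S = S} {Ss} move run) = valid-∷ escape (run2-valid run)
  where
  escape : (j : Fin (length Ss)) → ∃[ w ] w ∉ S × Odd (countIn w (S ∷ take (suc (toℕ j)) Ss))
  escape j = odd-outside S (take (suc (toℕ j)) Ss)
    (move2-beaten⇒⊈ {X = X} {γ} move
      (improving-beats-first-move (obj X) {γ} {S} (run2⇒improving run) j))

runPure-valid : {X : Weights n} {γ : Config n} {Ss : List (Subset n)} → RunPure X γ Ss → Valid Ss
runPure-valid (done _) = λ ()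
runPure-valid {X = X} {γ} (step {S = S} {Ss} move run) = valid-∷ escape (runPure-valid run)
  where
  escape : (j : Fin (length Ss)) → ∃[ w ] w ∉ S × Odd (countIn w (S ∷ take (suc (toℕ j)) Ss))
  escape j = odd-outside S (take (suc (toℕ j)) Ss)
    (movePure-beaten⇒⊈ {X = X} {γ} move
      (parity-⨁-pairs (take⁺ (suc (suc (toℕ j))) (runPure⇒pairs (step move run))))
      (improving-beats-first-move (obj X) {γ} {S} (runPure⇒improving run) j))

lemma3p2 : (n : ℕ) (X : Weights n) → WeightsInRange X →
    (γ₀ : Config n) (Ss : List (Subset n)) →
    (Run2 X γ₀ Ss → Valid Ss) × (RunPure X γ₀ Ss → Valid Ss)
lemma3p2 n X _ γ₀ Ss = run2-valid , runPure-valid
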